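{- Let $m\ge 2$ be an even integer, and let $n=a_0+a_1m+\cdots+a_km^k$ be the base-$m$ representation of $n$ ($a_j\in\{0,\ldots,m-1\}$). Then \[ p_m(n,-1)=(-1)^{a_0}\prod_{j=1}^{k}\frac{1+(-1)^{a_j}}{2}. \] In particular $p_m(n,-1)\in\{ -1,0,1\}$, and $p_m(n,-1)=0$ if and only if $a_j$ is odd for some $j\in\{1,\ldots,k\}$.
   Context: The $m$-ary partition polynomials $p_m(n,t)$ are defined by the power series expansion $\prod_{j=0}^{\infty}\frac{1}{1-tq^{m^j}}=\sum_{n=0}^{\infty}p_m(n,t)q^n$. An empty product equals $1$. -}

module Defs where

open import Data.Nat as ℕ using (ℕ; zero; suc; _≤ᵇ_)
open import Data.Integer using (ℤ; +_; -_; _+_; _*_; _^_; 0ℤ; 1ℤ)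
open import Data.List using (List; []; _∷_; map; upTo; foldr)
open import Data.Integer.DivMod using () renaming (_/_ to _/ℤ_)
open import Data.Vec using (Vec; []; _∷_)
open import Data.Bool using (if_then_else_)

-- Coefficient of q^n in  ∏_{d ∈ ds} 1/(1 - t q^d)  (product of geometric series
-- Σ_c t^c q^{c d}), extracted directly:
--   coeff [] n        = [n = 0]
--   coeff (d ∷ ds) n  = Σ_{c ≥ 0, c d ≤ n} t^c · coeff ds (n - c d)
-- sum of a list of integers
zsum : List ℤ → ℤ
zsum = foldr _+_ 0ℤ

coeff : ℤ → List ℕ → ℕ → ℤ
coeff t []       zero    = 1ℤ
coeff t []       (suc n) = 0ℤ
coeff t (d ∷ ds) n =
  zsum (map (λ c → if c ℕ.* d ≤ᵇ n then t ^ c * coeff t ds (n ℕ.∸ c ℕ.* d) else 0ℤ)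
           (upTo (suc n)))

-- p_m(n,t): coefficient of q^n in ∏_{j ≥ 0} 1/(1 - t q^{m^j}).
-- For m ≥ 2 only factors with m^j ≤ n can contribute to q^n, and m^j > n for j > n,
-- so the factors j = 0, …, n suffice (the others contribute only their constant term 1).
pm : ℕ → ℕ → ℤ → ℤ
pm m n t = coeff t (map (m ℕ.^_) (upTo (suc n))) n

baseVal : ℕ → ∀ {k} → Vec ℕ k → ℕ
baseVal m []       = 0
baseVal m (a ∷ as) = a ℕ.+ m ℕ.* baseVal m as

-- ∏_{a ∈ as} (1 + (-1)^a) / 2   (exact integer division; 1 + (-1)^a ∈ {0, 2})
halfProd : ∀ {k} → Vec ℕ k → ℤ
halfProd []       = 1ℤ
halfProd (a ∷ as) = ((1ℤ + (- 1ℤ) ^ a) /ℤ (+ 2)) * halfProd as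

-- For t = -1 the generating function G(q) = ∏ⱼ 1/(1 + q^(mʲ)) satisfies G(q) = G(q^m)/(1 + q).
-- Comparing coefficients, and using (-1)^m = 1 for even m, p(a + mN) = (-1)^a (p(0) + … + p(N))
-- for 0 ≤ a < m. Summing this over a block of consecutive indices, the partial sums
-- S(N) = p(0) + … + p(N) satisfy S(b + mM) = [b even] S(M): the alternating sum 1 - 1 + … of
-- length b + 1 is [b even], and it vanishes for the odd b = m - 1 that closes the previous block.
-- Hence S(n) is the product of [aⱼ even] over the digits of n, and p(n) = (-1)^(a₀) S((n - a₀)/m).
module Submission where

open import Data.Bool using (true; false; if_then_else_)
open import Data.Fin using (zero; suc)
open import Data.Fin.Properties using (any?)
open import Data.Integer using (ℤ; _+_; _*_; _^_; -_; 0ℤ; 1ℤ; -1ℤ)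
import Data.Integer as ℤ using (+_)
open import Data.Integer.DivMod using (_/_)
import Data.Integer.Properties as ℤ
open import Data.List using (List; []; _∷_; _∷ʳ_; map; applyUpTo; upTo)
open import Data.List.Properties using (map-upTo; map-applyUpTo; map-∘; map-++; upTo-∷ʳ)
open import Data.List.Relation.Unary.All as List using ([]; _∷_)
open import Data.List.Relation.Unary.All.Properties using (map⁺; applyUpTo⁺₂)
open import Data.Nat as ℕ
  using (ℕ; zero; suc; pred; _≤_; _<_; _≥_; _∸_; _≤ᵇ_; _≤?_; z≤n; s≤s; NonZero; >-nonZero)
open import Data.Nat.Divisibility
  using (_∣_; _∤_; _∣?_; _∣0; ∣-refl; ∣-trans; m∣m*n; n∣m*n; ∣m∣n⇒∣m+n; ∣m+n∣m⇒∣n; ∣m∸n∣n⇒∣m; >⇒∤)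
open import Data.Nat.Properties
  using (≤ᵇ-reflects-≤; ≤-refl; ≤-trans; <-trans; ≤-<-trans; <-≤-trans; ≰⇒>; <⇒≱; n<1+n;
         m≤n⇒m≤1+n; m<n⇒m<1+n; m≤m+n; m≤n+m; m≤n*m; m≤m*n; m∸n≤m; m∸n+n≡m; +-comm; *-suc;
         *-zeroʳ; *-monoʳ-≤; *-monoʳ-<; *-distribˡ-∸; suc-pred; m≤pred[n]⇒suc[m]≤n; m^n>0; ^-monoʳ-<;
         *-commutativeSemigroup)
open import Algebra.Properties.CommutativeSemigroup *-commutativeSemigroup using (x∙yz≈y∙xz)
open import Data.Product using (_×_; _,_; ∃-syntax)
open import Data.Sum using (_⊎_; inj₁; inj₂)
open import Data.Vec using (Vec; []; _∷_; lookup)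
open import Data.Vec.Relation.Unary.All using (All; []; _∷_)
open import Function using (_∘_)
open import Function.Bundles using (_⇔_; mk⇔)
open import Relation.Binary.PropositionalEquality
  using (_≡_; refl; sym; trans; cong; cong₂; subst; module ≡-Reasoning)
open import Relation.Nullary using (¬_; yes; no; contradiction)
open import Relation.Nullary.Decidable using (¬?; decidable-stable)
open import Relation.Nullary.Reflects using (ofʸ; ofⁿ)

open import Defs

private variable
  e m n L L′ : ℕ
  ds : List ℕ
  f g h : ℕ → ℤ

∑< : ℕ → (ℕ → ℤ) → ℤ
∑< L f = zsum (applyUpTo f L)

∑<-cong : ∀ L → (∀ i → i < L → f i ≡ g i) → ∑< L f ≡ ∑< L g
∑<-cong zero    eq = refl
∑<-cong (suc L) eq = cong₂ _+_ (eq 0 (s≤s z≤n)) (∑<-cong L (λ i → eq (suc i) ∘ s≤s))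

∑<-zero : ∀ L → (∀ i → i < L → f i ≡ 0ℤ) → ∑< L f ≡ 0ℤ
∑<-zero zero    eq = refl
∑<-zero (suc L) eq = cong₂ _+_ (eq 0 (s≤s z≤n)) (∑<-zero L (λ i → eq (suc i) ∘ s≤s))

∑<-truncate : L ≤ L′ → (∀ i → L ≤ i → f i ≡ 0ℤ) → ∑< L′ f ≡ ∑< L f
∑<-truncate {zero}  {L′}             _          vanish = ∑<-zero L′ (λ i _ → vanish i z≤n)
∑<-truncate {suc L} {suc L′} {f = f} (s≤s L≤L′) vanish =
  cong (f 0 +_) (∑<-truncate L≤L′ (λ i → vanish (suc i) ∘ s≤s))

*-distribˡ-∑< : ∀ t L f → ∑< L (λ i → t * f i) ≡ t * ∑< L f
*-distribˡ-∑< t zero    f = sym (ℤ.*-zeroʳ t)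
*-distribˡ-∑< t (suc L) f = begin
  t * f 0 + ∑< L (λ i → t * f (suc i)) ≡⟨ cong (t * f 0 +_) (*-distribˡ-∑< t L (f ∘ suc)) ⟩
  t * f 0 + t * ∑< L (f ∘ suc)         ≡⟨ ℤ.*-distribˡ-+ t (f 0) _ ⟨
  t * ∑< (suc L) f                     ∎
  where open ≡-Reasoning

∑≤ : ℕ → (ℕ → ℤ) → ℤ
∑≤ zero    f = f 0
∑≤ (suc N) f = ∑≤ N f + f (suc N)

∑≤-cong : ∀ N → (∀ i → i ≤ N → f i ≡ g i) → ∑≤ N f ≡ ∑≤ N g
∑≤-cong zero    eq = eq 0 z≤n
∑≤-cong (suc N) eq = cong₂ _+_ (∑≤-cong N (λ i → eq i ∘ m≤n⇒m≤1+n)) (eq (suc N) ≤-refl)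

geometricTerm : ℤ → ℕ → (ℕ → ℤ) → ℕ → ℕ → ℤ
geometricTerm t d g n c = if c ℕ.* d ≤ᵇ n then t ^ c * g (n ∸ c ℕ.* d) else 0ℤ

geometricTerm-≤ : ∀ t d g c → c ℕ.* d ≤ n → geometricTerm t d g n c ≡ t ^ c * g (n ∸ c ℕ.* d)
geometricTerm-≤ {n} t d g c cd≤n with c ℕ.* d ≤ᵇ n | ≤ᵇ-reflects-≤ (c ℕ.* d) n
... | true  | _        = refl
... | false | ofⁿ cd≰n = contradiction cd≤n cd≰n

geometricTerm-> : ∀ t d g c → n < c ℕ.* d → geometricTerm t d g n c ≡ 0ℤ
geometricTerm-> {n} t d g c n<cd with c ℕ.* d ≤ᵇ n | ≤ᵇ-reflects-≤ (c ℕ.* d) n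
... | true  | ofʸ cd≤n = contradiction cd≤n (<⇒≱ n<cd)
... | false | _        = refl

geometricTerm-cong : ∀ t d c → (∀ k → k ≤ n → g k ≡ h k) →
                     geometricTerm t d g n c ≡ geometricTerm t d h n c
geometricTerm-cong {n} t d c eq =
  cong (λ x → if c ℕ.* d ≤ᵇ n then t ^ c * x else 0ℤ) (eq (n ∸ c ℕ.* d) (m∸n≤m n (c ℕ.* d)))

geometricTerm-vanishing : ∀ t d g c → (c ℕ.* d ≤ n → g (n ∸ c ℕ.* d) ≡ 0ℤ) →
                          geometricTerm t d g n c ≡ 0ℤ
geometricTerm-vanishing {n} t d g c vanish with c ℕ.* d ≤? n
... | yes cd≤n = begin
  geometricTerm t d g n c    ≡⟨ geometricTerm-≤ t d g c cd≤n ⟩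
  t ^ c * g (n ∸ c ℕ.* d)    ≡⟨ cong (t ^ c *_) (vanish cd≤n) ⟩
  t ^ c * 0ℤ                 ≡⟨ ℤ.*-zeroʳ (t ^ c) ⟩
  0ℤ                         ∎
  where open ≡-Reasoning
... | no  cd≰n = geometricTerm-> t d g c (≰⇒> cd≰n)

coeff-∷ : ∀ t d ds n → coeff t (d ∷ ds) n ≡ ∑< (suc n) (geometricTerm t d (coeff t ds) n)
coeff-∷ t d ds n = cong zsum (map-upTo (geometricTerm t d (coeff t ds) n) (suc n))

coeff-∷-split : ∀ t d ds n →
                coeff t (d ∷ ds) n ≡ coeff t ds n + ∑< n (geometricTerm t d (coeff t ds) n ∘ suc)
coeff-∷-split t d ds n = trans (coeff-∷ t d ds n)
  (cong (_+ ∑< n (geometricTerm t d (coeff t ds) n ∘ suc)) (ℤ.*-identityˡ (coeff t ds n)))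

coeff-∷ʳ-large : ∀ t ds → n < e → coeff t (ds ∷ʳ e) n ≡ coeff t ds n
coeff-∷ʳ-large {n} {e} t [] n<e = begin
  coeff t (e ∷ []) n                                           ≡⟨ coeff-∷-split t e [] n ⟩
  coeff t [] n + ∑< n (geometricTerm t e (coeff t []) n ∘ suc) ≡⟨ cong (coeff t [] n +_) (∑<-zero n beyond) ⟩
  coeff t [] n + 0ℤ                                            ≡⟨ ℤ.+-identityʳ _ ⟩
  coeff t [] n                                                 ∎
  where
  open ≡-Reasoning
  beyond : ∀ c → c < n → geometricTerm t e (coeff t []) n (suc c) ≡ 0ℤ
  beyond c _ = geometricTerm-> t e (coeff t []) (suc c) (<-≤-trans n<e (m≤m+n e _))
coeff-∷ʳ-large {n} t (d ∷ ds) n<e = begin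
  coeff t (d ∷ ds ∷ʳ _) n                              ≡⟨ coeff-∷ t d (ds ∷ʳ _) n ⟩
  ∑< (suc n) (geometricTerm t d (coeff t (ds ∷ʳ _)) n) ≡⟨ ∑<-cong (suc n) (λ c _ → geometricTerm-cong t d c IH) ⟩
  ∑< (suc n) (geometricTerm t d (coeff t ds) n)        ≡⟨ coeff-∷ t d ds n ⟨
  coeff t (d ∷ ds) n                                   ∎
  where
  open ≡-Reasoning
  IH : ∀ k → k ≤ n → coeff t (ds ∷ʳ _) k ≡ coeff t ds k
  IH k k≤n = coeff-∷ʳ-large t ds (≤-<-trans k≤n n<e)

coeff-1∷-zero : ∀ t ds → coeff t (1 ∷ ds) 0 ≡ coeff t ds 0
coeff-1∷-zero t ds = trans (coeff-∷-split t 1 ds 0) (ℤ.+-identityʳ (coeff t ds 0))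

coeff-1∷-suc : ∀ t ds n → coeff t (1 ∷ ds) (suc n) ≡ coeff t ds (suc n) + t * coeff t (1 ∷ ds) n
coeff-1∷-suc t ds n = begin
  coeff t (1 ∷ ds) (suc n)                                    ≡⟨ coeff-∷-split t 1 ds (suc n) ⟩
  rest (suc n) + ∑< (suc n) (geometricTerm t 1 rest (suc n) ∘ suc)
    ≡⟨ cong (rest (suc n) +_) (∑<-cong (suc n) (λ c _ → shift c)) ⟩
  rest (suc n) + ∑< (suc n) (λ c → t * geometricTerm t 1 rest n c)
    ≡⟨ cong (rest (suc n) +_) (*-distribˡ-∑< t (suc n) (geometricTerm t 1 rest n)) ⟩
  rest (suc n) + t * ∑< (suc n) (geometricTerm t 1 rest n)
    ≡⟨ cong (λ x → rest (suc n) + t * x) (coeff-∷ t 1 ds n) ⟨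
  rest (suc n) + t * coeff t (1 ∷ ds) n                       ∎
  where
  open ≡-Reasoning
  rest : ℕ → ℤ
  rest = coeff t ds
  shift : ∀ c → geometricTerm t 1 rest (suc n) (suc c) ≡ t * geometricTerm t 1 rest n c
  shift c with c ℕ.* 1 ≤? n
  ... | yes c≤n = begin
    geometricTerm t 1 rest (suc n) (suc c) ≡⟨ geometricTerm-≤ t 1 rest (suc c) (s≤s c≤n) ⟩
    t * t ^ c * rest (n ∸ c ℕ.* 1)         ≡⟨ ℤ.*-assoc t (t ^ c) _ ⟩
    t * (t ^ c * rest (n ∸ c ℕ.* 1))       ≡⟨ cong (t *_) (geometricTerm-≤ t 1 rest c c≤n) ⟨
    t * geometricTerm t 1 rest n c         ∎
  ... | no c≰n = begin
    geometricTerm t 1 rest (suc n) (suc c) ≡⟨ geometricTerm-> t 1 rest (suc c) (s≤s (≰⇒> c≰n)) ⟩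
    0ℤ                                     ≡⟨ ℤ.*-zeroʳ t ⟨
    t * 0ℤ                                 ≡⟨ cong (t *_) (geometricTerm-> t 1 rest c (≰⇒> c≰n)) ⟨
    t * geometricTerm t 1 rest n c         ∎

coeff-scaled-nonmultiple : ∀ t m ds → m ∤ n → coeff t (map (m ℕ.*_) ds) n ≡ 0ℤ
coeff-scaled-nonmultiple {zero}  t m []       m∤0 = contradiction (m ∣0) m∤0
coeff-scaled-nonmultiple {suc n} t m []       _   = refl
coeff-scaled-nonmultiple {n}     t m (d ∷ ds) m∤n =
  trans (coeff-∷ t (m ℕ.* d) (map (m ℕ.*_) ds) n) (∑<-zero (suc n) (λ c _ →
    geometricTerm-vanishing t (m ℕ.* d) (coeff t (map (m ℕ.*_) ds)) c (λ c[md]≤n →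
      coeff-scaled-nonmultiple t m ds (λ m∣rest →
        m∤n (∣m∸n∣n⇒∣m m c[md]≤n m∣rest (∣-trans (m∣m*n d) (n∣m*n c)))))))

coeff-scaled-multiple : ∀ t m .{{_ : NonZero m}} → List.All (0 <_) ds → ∀ r →
                        coeff t (map (m ℕ.*_) ds) (m ℕ.* r) ≡ coeff t ds r
coeff-scaled-multiple t m       []            zero    = cong (coeff t []) (*-zeroʳ m)
coeff-scaled-multiple t (suc m) []            (suc r) = refl
coeff-scaled-multiple {d ∷ ds} t m (0<d ∷ pos) r = begin
  coeff t (map (m ℕ.*_) (d ∷ ds)) (m ℕ.* r)
    ≡⟨ coeff-∷ t (m ℕ.* d) (map (m ℕ.*_) ds) (m ℕ.* r) ⟩
  ∑< (suc (m ℕ.* r)) (geometricTerm t (m ℕ.* d) scaled (m ℕ.* r))  ≡⟨ ∑<-truncate (s≤s (m≤n*m r m)) beyond ⟩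
  ∑< (suc r) (geometricTerm t (m ℕ.* d) scaled (m ℕ.* r))
    ≡⟨ ∑<-cong (suc r) (λ c _ → geometricTerm-scaled c) ⟩
  ∑< (suc r) (geometricTerm t d (coeff t ds) r)                     ≡⟨ coeff-∷ t d ds r ⟨
  coeff t (d ∷ ds) r                                                ∎
  where
  open ≡-Reasoning
  scaled : ℕ → ℤ
  scaled = coeff t (map (m ℕ.*_) ds)
  c[md]≡m[cd] : ∀ c → c ℕ.* (m ℕ.* d) ≡ m ℕ.* (c ℕ.* d)
  c[md]≡m[cd] c = x∙yz≈y∙xz c m d
  beyond : ∀ c → suc r ≤ c → geometricTerm t (m ℕ.* d) scaled (m ℕ.* r) c ≡ 0ℤ
  beyond c r<c = geometricTerm-> t (m ℕ.* d) scaled c (subst (m ℕ.* r <_) (sym (c[md]≡m[cd] c))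
    (*-monoʳ-< m (<-≤-trans r<c (m≤m*n c d {{>-nonZero 0<d}}))))
  geometricTerm-scaled : ∀ c → geometricTerm t (m ℕ.* d) scaled (m ℕ.* r) c
                                ≡ geometricTerm t d (coeff t ds) r c
  geometricTerm-scaled c with c ℕ.* d ≤? r
  ... | yes cd≤r = begin
    geometricTerm t (m ℕ.* d) scaled (m ℕ.* r) c
      ≡⟨ geometricTerm-≤ t (m ℕ.* d) scaled c (subst (_≤ m ℕ.* r) (sym (c[md]≡m[cd] c)) (*-monoʳ-≤ m cd≤r)) ⟩
    t ^ c * scaled (m ℕ.* r ∸ c ℕ.* (m ℕ.* d)) ≡⟨ cong (λ k → t ^ c * scaled (m ℕ.* r ∸ k)) (c[md]≡m[cd] c) ⟩
    t ^ c * scaled (m ℕ.* r ∸ m ℕ.* (c ℕ.* d)) ≡⟨ cong (λ k → t ^ c * scaled k) (*-distribˡ-∸ m r (c ℕ.* d)) ⟨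
    t ^ c * scaled (m ℕ.* (r ∸ c ℕ.* d))       ≡⟨ cong (t ^ c *_) (coeff-scaled-multiple t m pos (r ∸ c ℕ.* d)) ⟩
    t ^ c * coeff t ds (r ∸ c ℕ.* d)           ≡⟨ geometricTerm-≤ t d (coeff t ds) c cd≤r ⟨
    geometricTerm t d (coeff t ds) r c         ∎
  ... | no cd≰r = trans
    (geometricTerm-> t (m ℕ.* d) scaled c (subst (m ℕ.* r <_) (sym (c[md]≡m[cd] c)) (*-monoʳ-< m (≰⇒> cd≰r))))
    (sym (geometricTerm-> t d (coeff t ds) c (≰⇒> cd≰r)))

*-suc-pred : ∀ m .{{_ : NonZero m}} N → m ℕ.* suc N ≡ suc (pred m ℕ.+ m ℕ.* N)
*-suc-pred m N = trans (*-suc m N) (cong (ℕ._+ m ℕ.* N) (sym (suc-pred m)))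

-- F is the series H(q^m)/(1 - tq), where H is the series with coefficients coeff t ds.
module _ (t : ℤ) (m : ℕ) .{{_ : NonZero m}} (ds : List ℕ) where

  private
    F scaled : ℕ → ℤ
    F = coeff t (1 ∷ map (m ℕ.*_) ds)
    scaled = coeff t (map (m ℕ.*_) ds)

  coeff-1∷-scaled-offset : ∀ N a → a < m →
    coeff t (1 ∷ map (m ℕ.*_) ds) (a ℕ.+ m ℕ.* N) ≡ t ^ a * coeff t (1 ∷ map (m ℕ.*_) ds) (m ℕ.* N)
  coeff-1∷-scaled-offset N zero    _   = sym (ℤ.*-identityˡ _)
  coeff-1∷-scaled-offset N (suc a) a<m = begin
    F (suc a ℕ.+ m ℕ.* N)                               ≡⟨ coeff-1∷-suc t (map (m ℕ.*_) ds) (a ℕ.+ m ℕ.* N) ⟩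
    scaled (suc a ℕ.+ m ℕ.* N) + t * F (a ℕ.+ m ℕ.* N)
      ≡⟨ cong₂ _+_ (coeff-scaled-nonmultiple t m ds m∤) (cong (t *_) IH) ⟩
    0ℤ + t * (t ^ a * F (m ℕ.* N))                      ≡⟨ ℤ.+-identityˡ _ ⟩
    t * (t ^ a * F (m ℕ.* N))                           ≡⟨ ℤ.*-assoc t (t ^ a) _ ⟨
    t ^ suc a * F (m ℕ.* N)                             ∎
    where
    open ≡-Reasoning
    IH : F (a ℕ.+ m ℕ.* N) ≡ t ^ a * F (m ℕ.* N)
    IH = coeff-1∷-scaled-offset N a (<-trans (n<1+n a) a<m)
    m∤ : m ∤ suc a ℕ.+ m ℕ.* N
    m∤ m∣ = >⇒∤ a<m (∣m+n∣m⇒∣n (subst (m ∣_) (+-comm (suc a) (m ℕ.* N)) m∣) (m∣m*n N))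

  coeff-1∷-scaled-step : List.All (0 <_) ds → ∀ N →
    coeff t (1 ∷ map (m ℕ.*_) ds) (m ℕ.* suc N)
      ≡ coeff t ds (suc N) + t ^ m * coeff t (1 ∷ map (m ℕ.*_) ds) (m ℕ.* N)
  coeff-1∷-scaled-step pos N = begin
    F (m ℕ.* suc N)                                      ≡⟨ cong F (*-suc-pred m N) ⟩
    F (suc (pred m ℕ.+ m ℕ.* N))                         ≡⟨ coeff-1∷-suc t (map (m ℕ.*_) ds) (pred m ℕ.+ m ℕ.* N) ⟩
    scaled (suc (pred m ℕ.+ m ℕ.* N)) + t * F (pred m ℕ.+ m ℕ.* N)
      ≡⟨ cong₂ _+_ (cong scaled (sym (*-suc-pred m N))) (cong (t *_) offset) ⟩
    scaled (m ℕ.* suc N) + t * (t ^ pred m * F (m ℕ.* N))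
      ≡⟨ cong₂ _+_ (coeff-scaled-multiple t m pos (suc N)) (sym (ℤ.*-assoc t (t ^ pred m) _)) ⟩
    coeff t ds (suc N) + t ^ suc (pred m) * F (m ℕ.* N)
      ≡⟨ cong (λ k → coeff t ds (suc N) + t ^ k * F (m ℕ.* N)) (suc-pred m) ⟩
    coeff t ds (suc N) + t ^ m * F (m ℕ.* N)             ∎
    where
    open ≡-Reasoning
    offset : F (pred m ℕ.+ m ℕ.* N) ≡ t ^ pred m * F (m ℕ.* N)
    offset = coeff-1∷-scaled-offset N (pred m) (m≤pred[n]⇒suc[m]≤n ≤-refl)

  coeff-1∷-scaled-multiple : List.All (0 <_) ds → t ^ m ≡ 1ℤ → ∀ N →
    coeff t (1 ∷ map (m ℕ.*_) ds) (m ℕ.* N) ≡ ∑≤ N (coeff t ds)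
  coeff-1∷-scaled-multiple pos tᵐ≡1 zero = begin
    F (m ℕ.* 0)        ≡⟨ cong F (*-zeroʳ m) ⟩
    F 0                ≡⟨ coeff-1∷-zero t (map (m ℕ.*_) ds) ⟩
    scaled 0           ≡⟨ cong scaled (*-zeroʳ m) ⟨
    scaled (m ℕ.* 0)   ≡⟨ coeff-scaled-multiple t m pos 0 ⟩
    coeff t ds 0       ∎
    where open ≡-Reasoning
  coeff-1∷-scaled-multiple pos tᵐ≡1 (suc N) = begin
    F (m ℕ.* suc N)                             ≡⟨ coeff-1∷-scaled-step pos N ⟩
    coeff t ds (suc N) + t ^ m * F (m ℕ.* N)
      ≡⟨ cong₂ (λ x y → coeff t ds (suc N) + x * y) tᵐ≡1 (coeff-1∷-scaled-multiple pos tᵐ≡1 N) ⟩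
    coeff t ds (suc N) + 1ℤ * ∑≤ N (coeff t ds) ≡⟨ cong (coeff t ds (suc N) +_) (ℤ.*-identityˡ _) ⟩
    coeff t ds (suc N) + ∑≤ N (coeff t ds)      ≡⟨ ℤ.+-comm (coeff t ds (suc N)) _ ⟩
    ∑≤ (suc N) (coeff t ds)                     ∎
    where open ≡-Reasoning

powers : ℕ → ℕ → List ℕ
powers m L = map (m ℕ.^_) (upTo L)

powers-suc : ∀ m L → powers m (suc L) ≡ 1 ∷ map (m ℕ.*_) (powers m L)
powers-suc m L = cong (1 ∷_) (begin
  map (m ℕ.^_) (applyUpTo suc L)     ≡⟨ map-applyUpTo suc (m ℕ.^_) L ⟩
  applyUpTo (λ i → m ℕ.* m ℕ.^ i) L  ≡⟨ map-upTo (λ i → m ℕ.* m ℕ.^ i) L ⟨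
  map (λ i → m ℕ.* m ℕ.^ i) (upTo L) ≡⟨ map-∘ (upTo L) ⟩
  map (m ℕ.*_) (powers m L)          ∎)
  where open ≡-Reasoning

powers-∷ʳ : ∀ m L → powers m (suc L) ≡ powers m L ∷ʳ m ℕ.^ L
powers-∷ʳ m L = trans (cong (map (m ℕ.^_)) (sym (upTo-∷ʳ L))) (map-++ (m ℕ.^_) (upTo L) (L ∷ []))

powers-positive : ∀ m .{{_ : NonZero m}} L → List.All (0 <_) (powers m L)
powers-positive m L = map⁺ (applyUpTo⁺₂ (λ i → i) L (m^n>0 m))

n<m^n : 1 < m → ∀ n → n < m ℕ.^ n
n<m^n 1<m zero    = s≤s z≤n
n<m^n 1<m (suc n) = ≤-<-trans (n<m^n 1<m n) (^-monoʳ-< _ 1<m (n<1+n n))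

pm-powers : ∀ t → 1 < m → n < L → pm m n t ≡ coeff t (powers m L) n
pm-powers {m} {n} {L} t 1<m n<L =
  subst (λ L → pm m n t ≡ coeff t (powers m L) n) (m∸n+n≡m n<L) (extend (L ∸ suc n))
  where
  extend : ∀ k → pm m n t ≡ coeff t (powers m (k ℕ.+ suc n)) n
  extend zero    = refl
  extend (suc k) = begin
    pm m n t                                   ≡⟨ extend k ⟩
    coeff t ps n                               ≡⟨ coeff-∷ʳ-large t ps (<-trans (m≤n+m (suc n) k) (n<m^n 1<m _)) ⟨
    coeff t (ps ∷ʳ m ℕ.^ (k ℕ.+ suc n)) n      ≡⟨ cong (λ qs → coeff t qs n) (powers-∷ʳ m (k ℕ.+ suc n)) ⟨
    coeff t (powers m (suc k ℕ.+ suc n)) n     ∎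
    where
    open ≡-Reasoning
    ps : List ℕ
    ps = powers m (k ℕ.+ suc n)

2∤1 : 2 ∤ 1
2∤1 = >⇒∤ ≤-refl

-1^-parity : ∀ n → (2 ∣ n × -1ℤ ^ n ≡ 1ℤ) ⊎ (2 ∤ n × -1ℤ ^ n ≡ -1ℤ)
-1^-parity 0 = inj₁ (2 ∣0 , refl)
-1^-parity 1 = inj₂ (2∤1 , refl)
-1^-parity (suc (suc n)) with -1^-parity n
... | inj₁ (2∣n , e) = inj₁ (∣m∣n⇒∣m+n ∣-refl 2∣n , cong (λ x → -1ℤ * (-1ℤ * x)) e)
... | inj₂ (2∤n , e) = inj₂ (2∤n ∘ (λ 2∣2+n → ∣m+n∣m⇒∣n 2∣2+n ∣-refl) , cong (λ x → -1ℤ * (-1ℤ * x)) e)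

-1^-even : 2 ∣ n → -1ℤ ^ n ≡ 1ℤ
-1^-even {n} 2∣n with -1^-parity n
... | inj₁ (_ , e)   = e
... | inj₂ (2∤n , _) = contradiction 2∣n 2∤n

-1^-odd : 2 ∤ n → -1ℤ ^ n ≡ -1ℤ
-1^-odd {n} 2∤n with -1^-parity n
... | inj₁ (2∣n , _) = contradiction 2∣n 2∤n
... | inj₂ (_ , e)   = e

-1^≡±1 : ∀ n → -1ℤ ^ n ≡ 1ℤ ⊎ -1ℤ ^ n ≡ -1ℤ
-1^≡±1 n with -1^-parity n
... | inj₁ (_ , e) = inj₁ e
... | inj₂ (_ , e) = inj₂ e

evenIndicator : ℕ → ℤ
evenIndicator n = (1ℤ + -1ℤ ^ n) / ℤ.+ 2

evenIndicator-even : 2 ∣ n → evenIndicator n ≡ 1ℤ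
evenIndicator-even 2∣n = cong (λ x → (1ℤ + x) / ℤ.+ 2) (-1^-even 2∣n)

evenIndicator-odd : 2 ∤ n → evenIndicator n ≡ 0ℤ
evenIndicator-odd 2∤n = cong (λ x → (1ℤ + x) / ℤ.+ 2) (-1^-odd 2∤n)

alternatingSum : ∀ n → ∑≤ n (-1ℤ ^_) ≡ evenIndicator n
alternatingSum zero    = refl
alternatingSum (suc n) = trans (cong (_+ -1ℤ ^ suc n) (alternatingSum n)) (step (-1^≡±1 n))
  where
  step : ∀ {x} → x ≡ 1ℤ ⊎ x ≡ -1ℤ → (1ℤ + x) / ℤ.+ 2 + -1ℤ * x ≡ (1ℤ + -1ℤ * x) / ℤ.+ 2
  step (inj₁ refl) = refl
  step (inj₂ refl) = refl

halfProd-allEven : ∀ {k} (as : Vec ℕ k) → (∀ j → 2 ∣ lookup as j) → halfProd as ≡ 1ℤ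
halfProd-allEven []       _    = refl
halfProd-allEven (a ∷ as) even = cong₂ _*_ (evenIndicator-even (even zero)) (halfProd-allEven as (even ∘ suc))

halfProd-someOdd : ∀ {k} (as : Vec ℕ k) → ∃[ j ] 2 ∤ lookup as j → halfProd as ≡ 0ℤ
halfProd-someOdd (a ∷ as) (zero  , odd) =
  trans (cong (_* halfProd as) (evenIndicator-odd odd)) (ℤ.*-zeroˡ (halfProd as))
halfProd-someOdd (a ∷ as) (suc j , odd) =
  trans (cong (evenIndicator a *_) (halfProd-someOdd as (j , odd))) (ℤ.*-zeroʳ (evenIndicator a))

signedHalfProd-values : ∀ {v} a {k} (as : Vec ℕ k) → v ≡ -1ℤ ^ a * halfProd as →
                        (v ≡ -1ℤ ⊎ v ≡ 0ℤ ⊎ v ≡ 1ℤ) × (v ≡ 0ℤ ⇔ (∃[ j ] 2 ∤ lookup as j))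
signedHalfProd-values a as refl with any? (λ j → ¬? (2 ∣? lookup as j))
... | yes odd rewrite halfProd-someOdd as odd | ℤ.*-zeroʳ (-1ℤ ^ a) =
  inj₂ (inj₁ refl) , mk⇔ (λ _ → odd) (λ _ → refl)
... | no noOdd
  rewrite halfProd-allEven as (λ j → decidable-stable (2 ∣? lookup as j) (noOdd ∘ (j ,_)))
        | ℤ.*-identityʳ (-1ℤ ^ a)
  with -1ℤ ^ a | -1^≡±1 a
...   | _ | inj₁ refl = inj₂ (inj₂ refl) , mk⇔ (λ ()) (λ odd → contradiction odd noOdd)
...   | _ | inj₂ refl = inj₁ refl , mk⇔ (λ ()) (λ odd → contradiction odd noOdd)

module _ (m : ℕ) (1<m : 1 < m) (2∣m : 2 ∣ m) where

  private instance
    m≢0 : NonZero m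
    m≢0 = >-nonZero (<-trans (s≤s z≤n) 1<m)

  p : ℕ → ℤ
  p n = pm m n -1ℤ

  pm-a+m*N : ∀ N a → a < m → p (a ℕ.+ m ℕ.* N) ≡ -1ℤ ^ a * ∑≤ N p
  pm-a+m*N N a a<m = begin
    p k                                                  ≡⟨ pm-powers -1ℤ 1<m (m<n⇒m<1+n (n<1+n k)) ⟩
    coeff -1ℤ (powers m (suc (suc k))) k                 ≡⟨ cong (λ qs → coeff -1ℤ qs k) (powers-suc m (suc k)) ⟩
    coeff -1ℤ (1 ∷ map (m ℕ.*_) ps) (a ℕ.+ m ℕ.* N)      ≡⟨ coeff-1∷-scaled-offset -1ℤ m ps N a a<m ⟩
    -1ℤ ^ a * coeff -1ℤ (1 ∷ map (m ℕ.*_) ps) (m ℕ.* N)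
      ≡⟨ cong (-1ℤ ^ a *_) (coeff-1∷-scaled-multiple -1ℤ m ps (powers-positive m (suc k)) (-1^-even 2∣m) N) ⟩
    -1ℤ ^ a * ∑≤ N (coeff -1ℤ ps)                        ≡⟨ cong (-1ℤ ^ a *_) (∑≤-cong N (λ i → sym ∘ stable i)) ⟩
    -1ℤ ^ a * ∑≤ N p                                     ∎
    where
    open ≡-Reasoning
    k : ℕ
    k = a ℕ.+ m ℕ.* N
    ps : List ℕ
    ps = powers m (suc k)
    stable : ∀ i → i ≤ N → p i ≡ coeff -1ℤ ps i
    stable i i≤N = pm-powers -1ℤ 1<m (s≤s (≤-trans i≤N (≤-trans (m≤n*m N m) (m≤n+m (m ℕ.* N) a))))

  2∤pred[m] : 2 ∤ pred m
  2∤pred[m] 2∣pred[m] = 2∤1 (∣m+n∣m⇒∣n 2∣pred[m]+1 2∣pred[m])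
    where
    2∣pred[m]+1 : 2 ∣ pred m ℕ.+ 1
    2∣pred[m]+1 = subst (2 ∣_) (trans (sym (suc-pred m)) (+-comm 1 (pred m))) 2∣m

  ∑≤-digit : ∀ M b → b < m → ∑≤ (b ℕ.+ m ℕ.* M) p ≡ ∑≤ b (-1ℤ ^_) * ∑≤ M p
  ∑≤-digit zero zero _ = trans (cong (λ k → ∑≤ k p) (*-zeroʳ m)) (sym (ℤ.*-identityˡ (p 0)))
  ∑≤-digit (suc M) zero _ = begin
    ∑≤ (m ℕ.* suc M) p                                  ≡⟨ cong (λ k → ∑≤ k p) (*-suc-pred m M) ⟩
    ∑≤ (pred m ℕ.+ m ℕ.* M) p + p (suc (pred m ℕ.+ m ℕ.* M))
      ≡⟨ cong₂ _+_ (∑≤-digit M (pred m) (m≤pred[n]⇒suc[m]≤n ≤-refl)) (cong p (sym (*-suc-pred m M))) ⟩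
    ∑≤ (pred m) (-1ℤ ^_) * ∑≤ M p + p (m ℕ.* suc M)
      ≡⟨ cong₂ _+_ (cong (_* ∑≤ M p) alternatingSum-pred[m]) (pm-a+m*N (suc M) 0 (<-trans (s≤s z≤n) 1<m)) ⟩
    0ℤ * ∑≤ M p + 1ℤ * ∑≤ (suc M) p                     ≡⟨ cong (_+ 1ℤ * ∑≤ (suc M) p) (ℤ.*-zeroˡ (∑≤ M p)) ⟩
    0ℤ + 1ℤ * ∑≤ (suc M) p                              ≡⟨ ℤ.+-identityˡ _ ⟩
    1ℤ * ∑≤ (suc M) p                                   ∎
    where
    open ≡-Reasoning
    alternatingSum-pred[m] : ∑≤ (pred m) (-1ℤ ^_) ≡ 0ℤ
    alternatingSum-pred[m] = trans (alternatingSum (pred m)) (evenIndicator-odd 2∤pred[m])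
  ∑≤-digit M (suc b) b<m = begin
    ∑≤ (b ℕ.+ m ℕ.* M) p + p (suc b ℕ.+ m ℕ.* M)
      ≡⟨ cong₂ _+_ (∑≤-digit M b (<-trans (n<1+n b) b<m)) (pm-a+m*N M (suc b) b<m) ⟩
    ∑≤ b (-1ℤ ^_) * ∑≤ M p + -1ℤ ^ suc b * ∑≤ M p       ≡⟨ ℤ.*-distribʳ-+ (∑≤ M p) (∑≤ b (-1ℤ ^_)) _ ⟨
    ∑≤ (suc b) (-1ℤ ^_) * ∑≤ M p                        ∎
    where open ≡-Reasoning

  ∑≤-baseVal : ∀ {k} (as : Vec ℕ k) → All (_< m) as → ∑≤ (baseVal m as) p ≡ halfProd as
  ∑≤-baseVal []       []           = refl
  ∑≤-baseVal (a ∷ as) (a<m ∷ as<m) = begin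
    ∑≤ (a ℕ.+ m ℕ.* baseVal m as) p     ≡⟨ ∑≤-digit (baseVal m as) a a<m ⟩
    ∑≤ a (-1ℤ ^_) * ∑≤ (baseVal m as) p ≡⟨ cong₂ _*_ (alternatingSum a) (∑≤-baseVal as as<m) ⟩
    evenIndicator a * halfProd as       ∎
    where open ≡-Reasoning

  pm-baseVal : ∀ a {k} (as : Vec ℕ k) → All (_< m) (a ∷ as) →
               p (baseVal m (a ∷ as)) ≡ -1ℤ ^ a * halfProd as
  pm-baseVal a as (a<m ∷ as<m) =
    trans (pm-a+m*N (baseVal m as) a a<m) (cong (-1ℤ ^ a *_) (∑≤-baseVal as as<m))

theorem3p3 : (m : ℕ) → m ≥ 2 → 2 ∣ m →
    (n k a₀ : ℕ) (as : Vec ℕ k) → All (_< m) (a₀ ∷ as) → n ≡ baseVal m (a₀ ∷ as) →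
      (pm m n (- 1ℤ) ≡ (- 1ℤ) ^ a₀ * halfProd as)
      × (pm m n (- 1ℤ) ≡ - 1ℤ ⊎ pm m n (- 1ℤ) ≡ 0ℤ ⊎ pm m n (- 1ℤ) ≡ 1ℤ)
      × (pm m n (- 1ℤ) ≡ 0ℤ ⇔ (∃[ j ] ¬ (2 ∣ lookup as j)))
theorem3p3 m m≥2 2∣m _ k a₀ as digits refl = value , signedHalfProd-values a₀ as value
  where
  value : pm m (baseVal m (a₀ ∷ as)) -1ℤ ≡ -1ℤ ^ a₀ * halfProd as
  value = pm-baseVal m m≥2 2∣m a₀ as digits
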